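{- Let $k\ge1$ and $n\ge0$. If the residues modulo $2^k$ of $\{f_w : w\in F_{\mathrm{odd}}(n)\}$ are equidistributed, then the residues modulo $2^k$ of $\{f_w : w\in F_{\mathrm{odd}}(n+1)\}$ are equidistributed.
   Context: For $n\ge 0$, let $F(n)$ be the set of all words $w=x_1\dotsb x_l$ with each $x_i\in\{1,2\}$ and $\sum_i x_i=n$, and $F=\coprod_{n\ge0}F(n)$ ($F(0)$ contains only the empty word $\emptyset$). The Young–Fibonacci graph has vertex set $F$, with an edge between $v\in F(n)$ and $w\in F(n+1)$ (written $v\in w^-$) iff either (1) $v$ is obtained from $w$ by changing into a $1$ some $2$ of $w$ that has no $1$ to its left, or (2) $v$ is obtained from $w$ by removing its leftmost $1$. The $f$-statistic is defined by $f_\emptyset=1$ and $f_w=\sum_{v\in w^- }f_v$. $F_{\mathrm{odd}}(n)$ is the set of $w\in F(n)$ with $f_w$ odd. The residues modulo $2^k$ of $\{f_w: w\in F_{\mathrm{odd}}(n)\}$ are called equidistributed if the numbers $m_i=|\{w\in F_{\mathrm{odd}}(n) : f_w\equiv i \pmod{2^k}\}|$ are equal for all odd integers $1\le i\le 2^k-1$. -}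

module Defs where

open import Data.Nat using (ℕ; zero; suc; _+_; _^_; _%_; _<_; _≤_)
open import Data.Bool using (Bool; true; false; _∧_; not; if_then_else_)
open import Data.List using (List; []; _∷_; _++_; map; length; filter; take; upTo)
open import Data.Nat.ListAction using (sum)
open import Data.Bool.ListAction using (all; any)
open import Data.Nat.Properties using (m^n≢0)
open import Data.Maybe using (Maybe; just; nothing)
open import Relation.Nullary using (Dec; yes; no)
open import Relation.Nullary.Decidable using (⌊_⌋)
open import Relation.Binary.PropositionalEquality using (_≡_)

data Letter : Set where
  one two : Letter

Word : Set
Word = List Letter

val : Letter → ℕ
val one = 1
val two = 2

rank : Word → ℕ
rank w = sum (map val w)

F : ℕ → List Word
F zero = [] ∷ []
F (suc zero) = (one ∷ []) ∷ []
F (suc (suc n)) = map (one ∷_) (F (suc n)) ++ map (two ∷_) (F n)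

isOne : Letter → Bool
isOne one = true
isOne two = false

isTwo : Letter → Bool
isTwo l = not (isOne l)

_≟L_ : Letter → Letter → Bool
one ≟L one = true
two ≟L two = true
_ ≟L _ = false

_≟W_ : Word → Word → Bool
[] ≟W [] = true
(x ∷ xs) ≟W (y ∷ ys) = (x ≟L y) ∧ (xs ≟W ys)
_ ≟W _ = false

at : ℕ → Word → Maybe Letter
at _ [] = nothing
at zero (x ∷ _) = just x
at (suc i) (_ ∷ xs) = at i xs

setOne : ℕ → Word → Word
setOne _ [] = []
setOne zero (_ ∷ xs) = one ∷ xs
setOne (suc i) (x ∷ xs) = x ∷ setOne i xs

removeLeftmostOne : Word → Maybe Word
removeLeftmostOne [] = nothing
removeLeftmostOne (one ∷ xs) = just xs
removeLeftmostOne (two ∷ xs) with removeLeftmostOne xs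
... | just ys = just (two ∷ ys)
... | nothing = nothing

isTwoAt : ℕ → Word → Bool
isTwoAt i w with at i w
... | just two = true
... | _ = false

rule1 : Word → Word → Bool
rule1 v w = any (λ i → isTwoAt i w ∧ all isTwo (take i w) ∧ (v ≟W setOne i w))
                (upTo (length w))

rule2 : Word → Word → Bool
rule2 v w with removeLeftmostOne w
... | just u = v ≟W u
... | nothing = false

isPred : Word → Word → Bool
isPred v w = rule1 v w Data.Bool.∨ rule2 v w

fAt : ℕ → Word → ℕ
fAt zero _ = 1
fAt (suc n) w = sum (map (λ v → if isPred v w then fAt n v else 0) (F n))

fStat : Word → ℕ
fStat w = fAt (rank w) w

Fodd : ℕ → List Word
Fodd n = filter (λ w → (fStat w % 2) Data.Nat.≟ 1) (F n)

count : ℕ → ℕ → ℕ → ℕ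
count k n i = length (filter (λ w → (_%_ (fStat w) (2 ^ k) {{m^n≢0 2 k}}) Data.Nat.≟ i) (Fodd n))

Equidistributed : ℕ → ℕ → Set
Equidistributed k n =
  ∀ i j → i % 2 ≡ 1 → j % 2 ≡ 1 → i < 2 ^ k → j < 2 ^ k → count k n i ≡ count k n j

-- The two rules say that the predecessors of 1w are just w, while those of 2w
-- are 1w and the words 2v with v ∈ w⁻.  Hence f is multiplicative along words:
-- f(1w) = f(w) and f(2w) = (|w| + 1) f(w).  Since F(n+2) = 1F(n+1) ⊔ 2F(n),
-- the values of f on F(n+2) are those on F(n+1) together with (n+1) times those
-- on F(n).  If n+1 is even the second part hits no odd residue, so F(n+2) and
-- F(n+1) have the same odd residue counts.  If n+1 is odd, multiplication by
-- n+1 permutes the odd residues mod 2^k, and F(n) has the same odd residue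
-- counts as F(n+1) because n is even; so both parts are equidistributed.
module Submission where

open import Defs
open import Data.Bool using (Bool; true; false; _∧_; _∨_; if_then_else_)
open import Data.Bool.Properties using (∧-zeroʳ; ∨-identityʳ)
open import Data.Bool.ListAction using (any; all; or)
open import Data.List using (List; []; _∷_; _++_; map; length; filter; take; upTo)
open import Data.List.Properties
  using ( map-++; map-∘; map-cong; map-cong-local; map-applyUpTo
        ; length-++; filter-++; filter-≐; filter-reject; filter-none )
open import Data.List.Relation.Unary.All as All using (All; []; _∷_)
open import Data.List.Relation.Unary.All.Properties using (++⁺; map⁺)
open import Data.Maybe using (just; nothing)
open import Data.Nat using (ℕ; zero; suc; _+_; _*_; _^_; _∸_; _<_; _≤_; s≤s; NonZero)
open import Data.Nat.Properties
open import Algebra.Properties.CommutativeSemigroup *-commutativeSemigroup using (x∙yz≈y∙xz)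
open import Data.Nat.DivMod
open import Data.Nat.Divisibility using (m∣m*n)
open import Data.Nat.ListAction using (sum)
open import Data.Nat.ListAction.Properties using (sum-++)
open import Data.Nat.Solver using (module +-*-Solver)
open import Data.Product using (∃-syntax; _,_)
open import Data.Sum using (_⊎_; inj₁; inj₂)
open import Function using (_∘_; id; _⇔_; mk⇔; Equivalence)
open import Relation.Nullary using (yes; no)
open import Relation.Unary using (Decidable; _⊆_; _≐_)
open import Relation.Binary.PropositionalEquality

fProduct : Word → ℕ
fProduct [] = 1
fProduct (one ∷ w) = fProduct w
fProduct (two ∷ w) = suc (rank w) * fProduct w

rank-F : ∀ n → All (λ w → rank w ≡ n) (F n)
rank-F zero = refl ∷ []
rank-F (suc zero) = refl ∷ []
rank-F (suc (suc n)) =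
  ++⁺ (map⁺ (All.map (cong suc) (rank-F (suc n)))) (map⁺ (All.map (cong (2 +_)) (rank-F n)))

fProduct-two∷-F : ∀ n → All (λ v → fProduct (two ∷ v) ≡ suc n * fProduct v) (F n)
fProduct-two∷-F n = All.map (λ {v} → cong (λ r → suc r * fProduct v)) (rank-F n)

rank≡0⇒[] : ∀ w → rank w ≡ 0 → w ≡ []
rank≡0⇒[] [] _ = refl
rank≡0⇒[] (one ∷ _) ()
rank≡0⇒[] (two ∷ _) ()

-- fAt (suc n) w unfolds to sumWhere (λ v → isPred v w) (fAt n) (F n).
sumWhere : (Word → Bool) → (Word → ℕ) → List Word → ℕ
sumWhere p h xs = sum (map (λ v → if p v then h v else 0) xs)

sumWhere-++ : ∀ p h xs ys → sumWhere p h (xs ++ ys) ≡ sumWhere p h xs + sumWhere p h ys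
sumWhere-++ p h xs ys =
  trans (cong sum (map-++ _ xs ys)) (sum-++ (map (λ v → if p v then h v else 0) xs) _)

sumWhere-F-suc-suc : ∀ p h n → sumWhere p h (F (2 + n)) ≡
  sumWhere (p ∘ (one ∷_)) (h ∘ (one ∷_)) (F (1 + n))
    + sumWhere (p ∘ (two ∷_)) (h ∘ (two ∷_)) (F n)
sumWhere-F-suc-suc p h n =
  trans (sumWhere-++ p h (map (one ∷_) (F (1 + n))) _)
        (cong₂ _+_ (cong sum (sym (map-∘ (F (1 + n))))) (cong sum (sym (map-∘ (F n)))))

sumWhere-false : ∀ h xs → sumWhere (λ _ → false) h xs ≡ 0
sumWhere-false h [] = refl
sumWhere-false h (_ ∷ xs) = sumWhere-false h xs

sumWhere-congˡ : ∀ {p q} h xs → (∀ v → p v ≡ q v) → sumWhere p h xs ≡ sumWhere q h xs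
sumWhere-congˡ h xs p≗q = cong sum (map-cong (λ v → cong (λ b → if b then h v else 0) (p≗q v)) xs)

sumWhere-congʳ : ∀ p {g h xs} → All (λ v → g v ≡ h v) xs → sumWhere p g xs ≡ sumWhere p h xs
sumWhere-congʳ p g≗h =
  cong sum (map-cong-local (All.map (λ {v} → cong (λ x → if p v then x else 0)) g≗h))

sumWhere-*ˡ : ∀ p h c xs → sumWhere p (λ v → c * h v) xs ≡ c * sumWhere p h xs
sumWhere-*ˡ p h c [] = sym (*-zeroʳ c)
sumWhere-*ˡ p h c (x ∷ xs) with p x
... | true = trans (cong (c * h x +_) (sumWhere-*ˡ p h c xs)) (sym (*-distribˡ-+ c (h x) _))
... | false = sumWhere-*ˡ p h c xs

sumWhere-≟W-F : ∀ n h u → rank u ≡ n → sumWhere (_≟W u) h (F n) ≡ h u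
sumWhere-≟W-F zero h u e rewrite rank≡0⇒[] u e = +-identityʳ (h [])
sumWhere-≟W-F (suc zero) h (one ∷ u) e rewrite rank≡0⇒[] u (suc-injective e) =
  +-identityʳ (h (one ∷ []))
sumWhere-≟W-F (suc (suc n)) h (one ∷ u) e = begin
  sumWhere (_≟W (one ∷ u)) h (F (2 + n))
    ≡⟨ sumWhere-F-suc-suc _ h n ⟩
  sumWhere (_≟W u) (h ∘ (one ∷_)) (F (1 + n)) + sumWhere (λ _ → false) (h ∘ (two ∷_)) (F n)
    ≡⟨ cong₂ _+_ (sumWhere-≟W-F (suc n) (h ∘ (one ∷_)) u (suc-injective e))
                 (sumWhere-false (h ∘ (two ∷_)) (F n)) ⟩
  h (one ∷ u) + 0
    ≡⟨ +-identityʳ _ ⟩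
  h (one ∷ u) ∎
  where open ≡-Reasoning
sumWhere-≟W-F (suc (suc n)) h (two ∷ u) e = begin
  sumWhere (_≟W (two ∷ u)) h (F (2 + n))
    ≡⟨ sumWhere-F-suc-suc _ h n ⟩
  sumWhere (λ _ → false) (h ∘ (one ∷_)) (F (1 + n)) + sumWhere (_≟W u) (h ∘ (two ∷_)) (F n)
    ≡⟨ cong₂ _+_ (sumWhere-false (h ∘ (one ∷_)) (F (1 + n)))
                 (sumWhere-≟W-F n (h ∘ (two ∷_)) u (suc-injective (suc-injective e))) ⟩
  h (two ∷ u) ∎
  where open ≡-Reasoning

rule1At : Word → Word → ℕ → Bool
rule1At v w i = isTwoAt i w ∧ all isTwo (take i w) ∧ (v ≟W setOne i w)

any-upTo-suc : ∀ (q : ℕ → Bool) n → any q (upTo (suc n)) ≡ q 0 ∨ any (q ∘ suc) (upTo n)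
any-upTo-suc q n =
  cong (λ bs → q 0 ∨ or bs) (trans (map-applyUpTo suc q n) (sym (map-applyUpTo id (q ∘ suc) n)))

any-cong : ∀ {q r : ℕ → Bool} xs → (∀ i → q i ≡ r i) → any q xs ≡ any r xs
any-cong xs q≗r = cong or (map-cong q≗r xs)

any-false : ∀ xs → any (λ (_ : ℕ) → false) xs ≡ false
any-false [] = refl
any-false (_ ∷ xs) = any-false xs

isTwoAt-suc : ∀ i x w → isTwoAt (suc i) (x ∷ w) ≡ isTwoAt i w
isTwoAt-suc i x w with at i w
... | just one = refl
... | just two = refl
... | nothing = refl

rule1-one : ∀ v w → rule1 v (one ∷ w) ≡ false
rule1-one v w = begin
  any (rule1At v (one ∷ w)) (upTo (1 + length w))
    ≡⟨ any-upTo-suc (rule1At v (one ∷ w)) (length w) ⟩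
  any (rule1At v (one ∷ w) ∘ suc) (upTo (length w))
    ≡⟨ any-cong (upTo (length w)) (λ i → ∧-zeroʳ (isTwoAt (suc i) (one ∷ w))) ⟩
  any (λ _ → false) (upTo (length w))
    ≡⟨ any-false (upTo (length w)) ⟩
  false ∎
  where open ≡-Reasoning

rule1-one-two : ∀ v w → rule1 (one ∷ v) (two ∷ w) ≡ (v ≟W w)
rule1-one-two v w = begin
  any (rule1At (one ∷ v) (two ∷ w)) (upTo (1 + length w))
    ≡⟨ any-upTo-suc (rule1At (one ∷ v) (two ∷ w)) (length w) ⟩
  (v ≟W w) ∨ any (rule1At (one ∷ v) (two ∷ w) ∘ suc) (upTo (length w))
    ≡⟨ cong ((v ≟W w) ∨_) (any-cong (upTo (length w)) noOtherTwo) ⟩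
  (v ≟W w) ∨ any (λ _ → false) (upTo (length w))
    ≡⟨ cong ((v ≟W w) ∨_) (any-false (upTo (length w))) ⟩
  (v ≟W w) ∨ false
    ≡⟨ ∨-identityʳ (v ≟W w) ⟩
  v ≟W w ∎
  where
  open ≡-Reasoning
  noOtherTwo : ∀ i → isTwoAt (suc i) (two ∷ w) ∧ all isTwo (take i w) ∧ false ≡ false
  noOtherTwo i = trans (cong (isTwoAt (suc i) (two ∷ w) ∧_) (∧-zeroʳ (all isTwo (take i w))))
                       (∧-zeroʳ (isTwoAt (suc i) (two ∷ w)))

rule1-two-two : ∀ v w → rule1 (two ∷ v) (two ∷ w) ≡ rule1 v w
rule1-two-two v w =
  trans (any-upTo-suc (rule1At (two ∷ v) (two ∷ w)) (length w)) (any-cong (upTo (length w)) shift)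
  where
  shift : ∀ i → rule1At (two ∷ v) (two ∷ w) (suc i) ≡ rule1At v w i
  shift i = cong (_∧ (all isTwo (take i w) ∧ (v ≟W setOne i w))) (isTwoAt-suc i two w)

rule2-two-one : ∀ v w → rule2 (one ∷ v) (two ∷ w) ≡ false
rule2-two-one v w with removeLeftmostOne w
... | just _ = refl
... | nothing = refl

rule2-two-two : ∀ v w → rule2 (two ∷ v) (two ∷ w) ≡ rule2 v w
rule2-two-two v w with removeLeftmostOne w
... | just _ = refl
... | nothing = refl

isPred-one : ∀ v w → isPred v (one ∷ w) ≡ (v ≟W w)
isPred-one v w = cong (_∨ (v ≟W w)) (rule1-one v w)

isPred-one-two : ∀ v w → isPred (one ∷ v) (two ∷ w) ≡ (v ≟W w)
isPred-one-two v w = trans (cong₂ _∨_ (rule1-one-two v w) (rule2-two-one v w)) (∨-identityʳ (v ≟W w))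

isPred-two-two : ∀ v w → isPred (two ∷ v) (two ∷ w) ≡ isPred v w
isPred-two-two v w = cong₂ _∨_ (rule1-two-two v w) (rule2-two-two v w)

sumWhere-isPred-fProduct : ∀ n w → rank w ≡ suc n →
  sumWhere (λ v → isPred v w) fProduct (F n) ≡ fProduct w
sumWhere-isPred-fProduct n (one ∷ w) e =
  trans (sumWhere-congˡ fProduct (F n) (λ v → isPred-one v w))
        (sumWhere-≟W-F n fProduct w (suc-injective e))
sumWhere-isPred-fProduct (suc zero) (two ∷ w) e
  rewrite rank≡0⇒[] w (suc-injective (suc-injective e)) = refl
sumWhere-isPred-fProduct (suc (suc m)) (two ∷ w) e = begin
  sumWhere (λ v → isPred v (two ∷ w)) fProduct (F (2 + m))
    ≡⟨ sumWhere-F-suc-suc _ fProduct m ⟩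
  sumWhere (λ v → isPred (one ∷ v) (two ∷ w)) fProduct (F (1 + m))
    + sumWhere (λ v → isPred (two ∷ v) (two ∷ w)) (λ v → suc (rank v) * fProduct v) (F m)
    ≡⟨ cong₂ _+_ (sumWhere-congˡ fProduct (F (1 + m)) (λ v → isPred-one-two v w))
                 (trans (sumWhere-congˡ _ (F m) (λ v → isPred-two-two v w))
                        (sumWhere-congʳ (λ v → isPred v w) (fProduct-two∷-F m))) ⟩
  sumWhere (_≟W w) fProduct (F (1 + m))
    + sumWhere (λ v → isPred v w) (λ v → suc m * fProduct v) (F m)
    ≡⟨ cong₂ _+_ (sumWhere-≟W-F (suc m) fProduct w rank-w) (sumWhere-*ˡ _ fProduct (suc m) (F m)) ⟩
  fProduct w + suc m * sumWhere (λ v → isPred v w) fProduct (F m)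
    ≡⟨ cong (λ s → fProduct w + suc m * s) (sumWhere-isPred-fProduct m w rank-w) ⟩
  fProduct w + suc m * fProduct w
    ≡⟨ cong (λ r → suc r * fProduct w) (sym rank-w) ⟩
  fProduct (two ∷ w) ∎
  where
  open ≡-Reasoning
  rank-w : rank w ≡ suc m
  rank-w = suc-injective (suc-injective e)

fAt≡fProduct : ∀ n w → rank w ≡ n → fAt n w ≡ fProduct w
fAt≡fProduct zero w e rewrite rank≡0⇒[] w e = refl
fAt≡fProduct (suc n) w e =
  trans (sumWhere-congʳ (λ v → isPred v w) (All.map (λ {v} → fAt≡fProduct n v) (rank-F n)))
        (sumWhere-isPred-fProduct n w e)

fStat≡fProduct : ∀ w → fStat w ≡ fProduct w
fStat≡fProduct w = fAt≡fProduct (rank w) w refl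


fValues : ℕ → List ℕ
fValues n = map fProduct (F n)

fValues-suc-suc : ∀ n → fValues (2 + n) ≡ fValues (1 + n) ++ map (suc n *_) (fValues n)
fValues-suc-suc n = begin
  map fProduct (map (one ∷_) (F (1 + n)) ++ map (two ∷_) (F n))
    ≡⟨ map-++ fProduct (map (one ∷_) (F (1 + n))) _ ⟩
  map fProduct (map (one ∷_) (F (1 + n))) ++ map fProduct (map (two ∷_) (F n))
    ≡⟨ cong₂ _++_ (sym (map-∘ (F (1 + n)))) (sym (map-∘ (F n))) ⟩
  fValues (1 + n) ++ map (fProduct ∘ (two ∷_)) (F n)
    ≡⟨ cong (fValues (1 + n) ++_) (map-cong-local (fProduct-two∷-F n)) ⟩
  fValues (1 + n) ++ map ((suc n *_) ∘ fProduct) (F n)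
    ≡⟨ cong (fValues (1 + n) ++_) (map-∘ (F n)) ⟩
  fValues (1 + n) ++ map (suc n *_) (fValues n) ∎
  where open ≡-Reasoning

length-filter-map : ∀ {A B : Set} {P : B → Set} (P? : Decidable P) (f : A → B) xs →
  length (filter P? (map f xs)) ≡ length (filter (P? ∘ f) xs)
length-filter-map P? f [] = refl
length-filter-map P? f (x ∷ xs) with P? (f x)
... | yes _ = cong suc (length-filter-map P? f xs)
... | no _ = length-filter-map P? f xs

filter-⊆ : ∀ {A : Set} {P Q : A → Set} (P? : Decidable P) (Q? : Decidable Q) → P ⊆ Q →
  ∀ xs → filter P? (filter Q? xs) ≡ filter P? xs
filter-⊆ P? Q? P⊆Q [] = refl
filter-⊆ P? Q? P⊆Q (x ∷ xs) with Q? x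
... | no ¬Qx = trans (filter-⊆ P? Q? P⊆Q xs) (sym (filter-reject P? (¬Qx ∘ P⊆Q)))
... | yes _ with P? x
...   | yes _ = cong (x ∷_) (filter-⊆ P? Q? P⊆Q xs)
...   | no _ = filter-⊆ P? Q? P⊆Q xs

%2≡0⊎%2≡1 : ∀ n → n % 2 ≡ 0 ⊎ n % 2 ≡ 1
%2≡0⊎%2≡1 n with n % 2 | m%n<n n 2
... | 0 | _ = inj₁ refl
... | 1 | _ = inj₂ refl
... | suc (suc _) | s≤s (s≤s ())

[1+n]%2≡1⇒n%2≡0 : ∀ n → suc n % 2 ≡ 1 → n % 2 ≡ 0
[1+n]%2≡1⇒n%2≡0 n [1+n]-odd with %2≡0⊎%2≡1 n
... | inj₁ n-even = n-even
... | inj₂ n-odd with trans (sym [1+n]-odd) (trans (%-distribˡ-+ 1 n 2) (cong (λ r → (1 + r) % 2) n-odd))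
...   | ()

*-%2≡0ʳ : ∀ m n → n % 2 ≡ 0 → (m * n) % 2 ≡ 0
*-%2≡0ʳ m n n-even = begin
  (m * n) % 2                ≡⟨ %-distribˡ-* m n 2 ⟩
  ((m % 2) * (n % 2)) % 2    ≡⟨ cong (λ r → ((m % 2) * r) % 2) n-even ⟩
  ((m % 2) * 0) % 2          ≡⟨ cong (_% 2) (*-zeroʳ (m % 2)) ⟩
  0 ∎
  where open ≡-Reasoning

*-%2≡1 : ∀ m n → m % 2 ≡ 1 → n % 2 ≡ 1 → (m * n) % 2 ≡ 1
*-%2≡1 m n m-odd n-odd = trans (%-distribˡ-* m n 2) (cong₂ (λ r s → (r * s) % 2) m-odd n-odd)

odd^[2^j]≡1+t*2^[1+j] : ∀ a → a % 2 ≡ 1 → ∀ j → ∃[ t ] a ^ (2 ^ j) ≡ 1 + t * 2 ^ suc j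
odd^[2^j]≡1+t*2^[1+j] a a-odd zero =
  a / 2 , trans (*-identityʳ a) (trans (m≡m%n+[m/n]*n a 2) (cong (_+ a / 2 * 2) a-odd))
odd^[2^j]≡1+t*2^[1+j] a a-odd (suc j) with odd^[2^j]≡1+t*2^[1+j] a a-odd j
... | t , a^2^j≡ = t + t * t * 2 ^ j , (begin
  a ^ (2 * 2 ^ j)
    ≡⟨ cong (a ^_) (*-comm 2 (2 ^ j)) ⟩
  a ^ (2 ^ j * 2)
    ≡⟨ sym (^-*-assoc a (2 ^ j) 2) ⟩
  a ^ 2 ^ j * (a ^ 2 ^ j * 1)
    ≡⟨ cong (λ y → y * (y * 1)) a^2^j≡ ⟩
  (1 + t * (2 * 2 ^ j)) * ((1 + t * (2 * 2 ^ j)) * 1)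
    ≡⟨ solve 2 (λ t P → (con 1 :+ t :* (con 2 :* P)) :* ((con 1 :+ t :* (con 2 :* P)) :* con 1)
                       := con 1 :+ (t :+ t :* t :* P) :* (con 2 :* (con 2 :* P))) refl t (2 ^ j) ⟩
  1 + (t + t * t * 2 ^ j) * 2 ^ suc (suc j) ∎)
  where
  open ≡-Reasoning
  open +-*-Solver

module OddResidues (k : ℕ) where

  M : ℕ
  M = 2 ^ suc k

  instance
    M≢0 : NonZero M
    M≢0 = m^n≢0 2 (suc k)

  %M≡⇒%2≡ : ∀ {x i} → x % M ≡ i → x % 2 ≡ i % 2
  %M≡⇒%2≡ {x} x≡i = trans (sym (m∣n⇒o%n%m≡o%m 2 M x (m∣m*n (2 ^ k)))) (cong (_% 2) x≡i)

  [m*[n%M]]%M≡[m*n]%M : ∀ m n → (m * (n % M)) % M ≡ (m * n) % M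
  [m*[n%M]]%M≡[m*n]%M m n = begin
    (m * (n % M)) % M            ≡⟨ %-distribˡ-* m (n % M) M ⟩
    ((m % M) * (n % M % M)) % M  ≡⟨ cong (λ r → ((m % M) * r) % M) (m%n%n≡m%n n M) ⟩
    ((m % M) * (n % M)) % M      ≡⟨ sym (%-distribˡ-* m n M) ⟩
    (m * n) % M ∎
    where open ≡-Reasoning

  odd⇒invertible : ∀ a → a % 2 ≡ 1 → ∃[ b ] (a * b) % M ≡ 1
  odd⇒invertible a a-odd with odd^[2^j]≡1+t*2^[1+j] a a-odd k
  ... | t , a^2^k≡ = a ^ (2 ^ k ∸ 1) , (begin
    (a * a ^ (2 ^ k ∸ 1)) % M  ≡⟨ cong (λ e → a ^ e % M) 1+[2^k∸1]≡2^k ⟩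
    a ^ (2 ^ k) % M            ≡⟨ cong (_% M) a^2^k≡ ⟩
    (1 + t * M) % M            ≡⟨ [m+kn]%n≡m%n 1 t M ⟩
    1 % M                      ≡⟨ m<n⇒m%n≡m (*-monoʳ-≤ 2 (m^n>0 2 k)) ⟩
    1 ∎)
    where
    open ≡-Reasoning
    1+[2^k∸1]≡2^k : 1 + (2 ^ k ∸ 1) ≡ 2 ^ k
    1+[2^k∸1]≡2^k = trans (+-comm 1 (2 ^ k ∸ 1)) (m∸n+n≡m (m^n>0 2 k))

  module _ (a b : ℕ) (ab≡1 : (a * b) % M ≡ 1) where

    cancel-inverse : ∀ x → (a * (b * x)) % M ≡ x % M
    cancel-inverse x = begin
      (a * (b * x)) % M              ≡⟨ cong (_% M) (sym (*-assoc a b x)) ⟩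
      (a * b * x) % M                ≡⟨ %-distribˡ-* (a * b) x M ⟩
      ((a * b) % M * (x % M)) % M    ≡⟨ cong (λ r → (r * (x % M)) % M) ab≡1 ⟩
      (1 * (x % M)) % M              ≡⟨ cong (_% M) (*-identityˡ (x % M)) ⟩
      x % M % M                      ≡⟨ m%n%n≡m%n x M ⟩
      x % M ∎
      where open ≡-Reasoning

    *-residue≐ : ∀ i → i < M → (λ x → (a * x) % M ≡ i) ≐ (λ x → x % M ≡ (b * i) % M)
    *-residue≐ i i<M = (λ {x} → to x) , (λ {x} → from x)
      where
      open ≡-Reasoning
      to : ∀ x → (a * x) % M ≡ i → x % M ≡ (b * i) % M
      to x ax≡i = begin
        x % M                    ≡⟨ sym (cancel-inverse x) ⟩
        (a * (b * x)) % M        ≡⟨ cong (_% M) (x∙yz≈y∙xz a b x) ⟩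
        (b * (a * x)) % M        ≡⟨ sym ([m*[n%M]]%M≡[m*n]%M b (a * x)) ⟩
        (b * ((a * x) % M)) % M  ≡⟨ cong (λ r → (b * r) % M) ax≡i ⟩
        (b * i) % M ∎
      from : ∀ x → x % M ≡ (b * i) % M → (a * x) % M ≡ i
      from x x≡bi = begin
        (a * x) % M              ≡⟨ sym ([m*[n%M]]%M≡[m*n]%M a x) ⟩
        (a * (x % M)) % M        ≡⟨ cong (λ r → (a * r) % M) x≡bi ⟩
        (a * ((b * i) % M)) % M  ≡⟨ [m*[n%M]]%M≡[m*n]%M a (b * i) ⟩
        (a * (b * i)) % M        ≡⟨ cancel-inverse i ⟩
        i % M                    ≡⟨ m<n⇒m%n≡m i<M ⟩
        i ∎

    inverse-odd : b % 2 ≡ 1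
    inverse-odd with %2≡0⊎%2≡1 b
    ... | inj₂ b-odd = b-odd
    ... | inj₁ b-even with trans (sym (%M≡⇒%2≡ ab≡1)) (*-%2≡0ʳ a b b-even)
    ...   | ()

  residueCount : List ℕ → ℕ → ℕ
  residueCount ns i = length (filter (λ x → x % M ≟ i) ns)

  OddEquidistributed : List ℕ → Set
  OddEquidistributed ns =
    ∀ i j → i % 2 ≡ 1 → j % 2 ≡ 1 → i < M → j < M → residueCount ns i ≡ residueCount ns j

  residueCount-++ : ∀ xs ys i → residueCount (xs ++ ys) i ≡ residueCount xs i + residueCount ys i
  residueCount-++ xs ys i =
    trans (cong length (filter-++ (λ x → x % M ≟ i) xs ys)) (length-++ (filter (λ x → x % M ≟ i) xs))

  residueCount-*even : ∀ a ns i → a % 2 ≡ 0 → i % 2 ≡ 1 → residueCount (map (a *_) ns) i ≡ 0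
  residueCount-*even a ns i a-even i-odd =
    trans (length-filter-map (λ x → x % M ≟ i) (a *_) ns)
          (cong length (filter-none (λ x → (a * x) % M ≟ i) (All.universal ax≢i ns)))
    where
    ax≢i : ∀ x → (a * x) % M ≢ i
    ax≢i x ax≡i with trans (sym (trans (%M≡⇒%2≡ ax≡i) i-odd))
                           (trans (cong (_% 2) (*-comm a x)) (*-%2≡0ʳ x a a-even))
    ... | ()

  residueCount-*odd : ∀ a b → (a * b) % M ≡ 1 → ∀ ns i → i < M →
    residueCount (map (a *_) ns) i ≡ residueCount ns ((b * i) % M)
  residueCount-*odd a b ab≡1 ns i i<M =
    trans (length-filter-map (λ x → x % M ≟ i) (a *_) ns)
          (cong length (filter-≐ (λ x → (a * x) % M ≟ i) (λ x → x % M ≟ (b * i) % M)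
                                 (*-residue≐ a b ab≡1 i i<M) ns))

  OddEquidistributed-transport : ∀ xs ys →
    (∀ i → i % 2 ≡ 1 → residueCount xs i ≡ residueCount ys i) →
    OddEquidistributed xs → OddEquidistributed ys
  OddEquidistributed-transport xs ys xs≗ys eq i j i-odd j-odd i<M j<M =
    trans (sym (xs≗ys i i-odd)) (trans (eq i j i-odd j-odd i<M j<M) (xs≗ys j j-odd))

  OddEquidistributed-++ : ∀ xs ys →
    OddEquidistributed xs → OddEquidistributed ys → OddEquidistributed (xs ++ ys)
  OddEquidistributed-++ xs ys eq₁ eq₂ i j i-odd j-odd i<M j<M = begin
    residueCount (xs ++ ys) i                  ≡⟨ residueCount-++ xs ys i ⟩
    residueCount xs i + residueCount ys i      ≡⟨ cong₂ _+_ (eq₁ i j i-odd j-odd i<M j<M)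
                                                             (eq₂ i j i-odd j-odd i<M j<M) ⟩
    residueCount xs j + residueCount ys j      ≡⟨ sym (residueCount-++ xs ys j) ⟩
    residueCount (xs ++ ys) j ∎
    where open ≡-Reasoning

  OddEquidistributed-*odd : ∀ a ns → a % 2 ≡ 1 →
    OddEquidistributed ns → OddEquidistributed (map (a *_) ns)
  OddEquidistributed-*odd a ns a-odd eq i j i-odd j-odd i<M j<M with odd⇒invertible a a-odd
  ... | b , ab≡1 = begin
    residueCount (map (a *_) ns) i  ≡⟨ residueCount-*odd a b ab≡1 ns i i<M ⟩
    residueCount ns ((b * i) % M)   ≡⟨ eq _ _ (bx%M-odd i i-odd) (bx%M-odd j j-odd)
                                              (m%n<n (b * i) M) (m%n<n (b * j) M) ⟩
    residueCount ns ((b * j) % M)   ≡⟨ sym (residueCount-*odd a b ab≡1 ns j j<M) ⟩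
    residueCount (map (a *_) ns) j ∎
    where
    open ≡-Reasoning
    bx%M-odd : ∀ x → x % 2 ≡ 1 → (b * x) % M % 2 ≡ 1
    bx%M-odd x x-odd =
      trans (sym (%M≡⇒%2≡ refl)) (*-%2≡1 b x (inverse-odd a b ab≡1) x-odd)

  residueCount-fValues-even : ∀ n i → n % 2 ≡ 0 → i % 2 ≡ 1 →
    residueCount (fValues (suc n)) i ≡ residueCount (fValues n) i
  residueCount-fValues-even zero i _ _ = refl
  residueCount-fValues-even (suc m) i n-even i-odd = begin
    residueCount (fValues (2 + m)) i
      ≡⟨ cong (λ ns → residueCount ns i) (fValues-suc-suc m) ⟩
    residueCount (fValues (1 + m) ++ map (suc m *_) (fValues m)) i
      ≡⟨ residueCount-++ (fValues (1 + m)) _ i ⟩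
    residueCount (fValues (1 + m)) i + residueCount (map (suc m *_) (fValues m)) i
      ≡⟨ cong (residueCount (fValues (1 + m)) i +_)
              (residueCount-*even (suc m) (fValues m) i n-even i-odd) ⟩
    residueCount (fValues (1 + m)) i + 0
      ≡⟨ +-identityʳ _ ⟩
    residueCount (fValues (1 + m)) i ∎
    where open ≡-Reasoning

  OddEquidistributed-fValues-suc : ∀ n →
    OddEquidistributed (fValues n) → OddEquidistributed (fValues (suc n))
  OddEquidistributed-fValues-suc zero eq = eq
  OddEquidistributed-fValues-suc (suc m) eq with %2≡0⊎%2≡1 (suc m)
  ... | inj₁ n-even =
    OddEquidistributed-transport (fValues (1 + m)) (fValues (2 + m))
      (λ i i-odd → sym (residueCount-fValues-even (suc m) i n-even i-odd)) eq
  ... | inj₂ n-odd =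
    subst OddEquidistributed (sym (fValues-suc-suc m))
      (OddEquidistributed-++ (fValues (1 + m)) _ eq
        (OddEquidistributed-*odd (suc m) (fValues m) n-odd eqₘ))
    where
    eqₘ : OddEquidistributed (fValues m)
    eqₘ = OddEquidistributed-transport (fValues (1 + m)) (fValues m)
            (λ i i-odd → residueCount-fValues-even m i ([1+n]%2≡1⇒n%2≡0 m n-odd) i-odd) eq

  count≡residueCount : ∀ n i → i % 2 ≡ 1 → count (suc k) n i ≡ residueCount (fValues n) i
  count≡residueCount n i i-odd = begin
    length (filter (λ w → fStat w % M ≟ i) (filter (λ w → fStat w % 2 ≟ 1) (F n)))
      ≡⟨ cong length (filter-⊆ (λ w → fStat w % M ≟ i) (λ w → fStat w % 2 ≟ 1)
                               (λ {w} f≡i → trans (%M≡⇒%2≡ f≡i) i-odd) (F n)) ⟩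
    length (filter (λ w → fStat w % M ≟ i) (F n))
      ≡⟨ cong length (filter-≐ (λ w → fStat w % M ≟ i) (λ w → fProduct w % M ≟ i)
                               fStat≐fProduct (F n)) ⟩
    length (filter (λ w → fProduct w % M ≟ i) (F n))
      ≡⟨ sym (length-filter-map (λ x → x % M ≟ i) fProduct (F n)) ⟩
    residueCount (fValues n) i ∎
    where
    open ≡-Reasoning
    fStat≐fProduct : (λ w → fStat w % M ≡ i) ≐ (λ w → fProduct w % M ≡ i)
    fStat≐fProduct = (λ {w} → trans (cong (_% M) (sym (fStat≡fProduct w))))
                   , (λ {w} → trans (cong (_% M) (fStat≡fProduct w)))

  Equidistributed⇔ : ∀ n → Equidistributed (suc k) n ⇔ OddEquidistributed (fValues n)
  Equidistributed⇔ n = mk⇔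
    (λ eq i j i-odd j-odd i<M j<M → trans (sym (count≡residueCount n i i-odd))
                                      (trans (eq i j i-odd j-odd i<M j<M) (count≡residueCount n j j-odd)))
    (λ eq i j i-odd j-odd i<M j<M → trans (count≡residueCount n i i-odd)
                                      (trans (eq i j i-odd j-odd i<M j<M) (sym (count≡residueCount n j j-odd))))

mainTheorem7 : (k n : ℕ) → 1 ≤ k → Equidistributed k n → Equidistributed k (n + 1)
mainTheorem7 (suc k) n _ eq =
  subst (Equidistributed (suc k)) (+-comm 1 n)
    (Equivalence.from (Equidistributed⇔ (suc n))
      (OddEquidistributed-fValues-suc n (Equivalence.to (Equidistributed⇔ n) eq)))
  where open OddResidues k
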